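{- Let $d$ be odd. When the input is a $d$-regular graph on $n$ vertices, the median algorithm outputs in $1$ round (in the CONGEST model) a cut of size at least $\frac{n}{2}+\frac{(d-1)(d+1)}{4}$.
   Context: A cut of a graph $G$ is a bipartition $(A,B)$ of $V(G)$; its size is the number of edges between $A$ and $B$. CONGEST model: each vertex of an $n$-vertex graph is a processor with unbounded computational power and a unique ID (an integer between $1$ and $\mathrm{poly}(n)$); in synchronous rounds each vertex sends a message of $O(\log n)$ bits to each neighbor; at the end each vertex outputs its side of the cut. Median algorithm: in one round every vertex $v$ collects the list of IDs of its neighbors (a list of odd length $d$); $v$ is placed in $A$ if its own ID is smaller than the median of this list, and in $B$ if its own ID is larger. -}

module Defs where

open import Data.Bool using (Bool; true; false; if_then_else_; _∧_; not)
open import Data.Nat using (ℕ; zero; suc; _+_; _*_; _∸_; _/_; _<_; _<ᵇ_; _≤_)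
open import Data.Nat.Properties using (≤-decTotalOrder)
open import Data.Fin using (Fin; toℕ)
open import Data.List using (List; []; _∷_; length; filterᵇ; map; allFin; concatMap)
open import Data.Product using (_×_; _,_; proj₁; proj₂)
open import Function.Definitions using (Injective)
open import Relation.Binary.PropositionalEquality using (_≡_)
open import Data.List.Sort ≤-decTotalOrder using (sort)

record SimpleGraph (n : ℕ) : Set where
  field
    adj    : Fin n → Fin n → Bool
    sym    : ∀ u v → adj u v ≡ adj v u
    irrefl : ∀ v → adj v v ≡ false
open SimpleGraph public

neighbours : ∀ {n} → SimpleGraph n → Fin n → List (Fin n)
neighbours G v = filterᵇ (adj G v) (allFin n)
  where n = _

degree : ∀ {n} → SimpleGraph n → Fin n → ℕ
degree G v = length (neighbours G v)

Regular : ∀ {n} → ℕ → SimpleGraph n → Set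
Regular d G = ∀ v → degree G v ≡ d

IDAssignment : ℕ → Set
IDAssignment n = Fin n → ℕ

UniqueIDs : ∀ {n} → IDAssignment n → Set
UniqueIDs {n} id = Injective _≡_ _≡_ id

-- k-th element (0-based) of a list, default 0 if out of range.
nth : List ℕ → ℕ → ℕ
nth []       _       = 0
nth (x ∷ xs) zero    = x
nth (x ∷ xs) (suc k) = nth xs k

-- Median of a list (meaningful for odd length): the middle element
-- of the sorted list.
median : List ℕ → ℕ
median xs = nth (sort xs) (length xs / 2)

neighbourIDs : ∀ {n} → SimpleGraph n → IDAssignment n → Fin n → List ℕ
neighbourIDs G id v = map id (neighbours G v)

-- Output of the median algorithm: true = side A, false = side B.
-- v is put in A iff its ID is smaller than the median of its neighbours' IDs.
medianSide : ∀ {n} → SimpleGraph n → IDAssignment n → Fin n → Bool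
medianSide G id v = id v <ᵇ median (neighbourIDs G id v)

-- All unordered pairs {u,v} of vertices, listed as (u , v) with u < v.
orderedPairs : ∀ n → List (Fin n × Fin n)
orderedPairs n = concatMap (λ u → map (u ,_) (filterᵇ (λ v → toℕ u <ᵇ toℕ v) (allFin n))) (allFin n)

_≠ᵇ_ : Bool → Bool → Bool
true  ≠ᵇ b = not b
false ≠ᵇ b = b

cutSize : ∀ {n} → SimpleGraph n → (Fin n → Bool) → ℕ
cutSize {n} G side =
  length (filterᵇ (λ p → adj G (proj₁ p) (proj₂ p) ∧ (side (proj₁ p) ≠ᵇ side (proj₂ p)))
                  (orderedPairs n))

-- Write d = 2k + 1. Call a neighbour u of v earlier than v if id u < id v when
-- v is on side A, and if id u > id v when v is on side B. By the median rule,
-- every vertex has at most k earlier and at least k + 1 later neighbours.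
-- Charge each uncut edge to its later endpoint (both endpoints are on the same
-- side, so they use the same order). The charge of v is at most k and at most
-- the rank of v in the order of its side, while its rank in the opposite order
-- exceeds k. As the ranks in either order run through 0, …, n - 1, summing
--   charge v + (k ∸ rank₍<₎ v) + (k ∸ rank₍>₎ v) ≤ k
-- over all v gives uncut + k (k + 1) ≤ n k, and 2 cut + 2 uncut = n d finishes.

module Submission where

open import Defs
open import Data.Nat using (ℕ; suc; _+_; _*_; _∸_; _≤_)
open import Relation.Binary.PropositionalEquality using (_≡_)

open import Data.Nat using (zero; _<_; _<ᵇ_; _/_; s≤s; z≤n)
open import Data.Nat.Properties
open import Data.Nat.Divisibility using (divides)
open import Data.Nat.DivMod using (+-distrib-/-∣ˡ; m*n/n≡m)
open import Data.Nat.Tactic.RingSolver using (solve-∀)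
open import Data.Bool using (Bool; true; false; _∧_; not; T)
open import Data.Bool.Properties using (∧-comm)
open import Data.Unit using (tt)
open import Data.Sum using (inj₁; inj₂)
open import Data.Product using (_×_; _,_; ∃; proj₁; proj₂)
open import Data.Fin as Fin using (Fin; toℕ; fromℕ<; punchIn; punchOut)
import Data.Fin.Properties as Finₚ
open import Data.Fin.Permutation using (Permutation; permutation)
open import Data.List using (List; []; _∷_; _++_; length; filterᵇ; map; tabulate; allFin; concatMap)
open import Data.List.Properties using (length-map; length-++; length-filter; filter-++; filter-none)
open import Data.List.Relation.Unary.All as All using (All; _∷_)
open import Data.List.Relation.Unary.AllPairs using (AllPairs; _∷_)
open import Data.List.Relation.Unary.Linked.Properties using (Linked⇒AllPairs)
open import Data.List.Relation.Binary.Permutation.Propositional using (_↭_)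
open import Data.List.Relation.Binary.Permutation.Propositional.Properties using (↭-length; filter-↭)
open import Data.List.Sort ≤-decTotalOrder using (sort; sort-↗; sort-↭)
open import Function using (_∘_)
open import Function.Definitions using (Injective)
open import Relation.Nullary using (¬_; yes; no; contradiction)
open import Relation.Nullary.Decidable using (T?)
open import Relation.Binary.PropositionalEquality using (_≢_; refl; trans; cong; cong₂; subst; ≢-sym)
import Relation.Binary.PropositionalEquality as ≡
open import Algebra.Properties.CommutativeMonoid.Sum +-0-commutativeMonoid
  using (sum; sum-cong-≗; ∑-comm; ∑-distrib-+; sum-permute; sum-remove)

𝟙 : Bool → ℕ
𝟙 true  = 1
𝟙 false = 0

𝟙-split : ∀ a b → 𝟙 a ≡ 𝟙 (a ∧ b) + 𝟙 (a ∧ not b)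
𝟙-split true  true  = refl
𝟙-split true  false = refl
𝟙-split false _     = refl

𝟙-mono : ∀ {a b} → (T a → T b) → 𝟙 a ≤ 𝟙 b
𝟙-mono {false} _ = z≤n
𝟙-mono {true} {true}  _ = ≤-refl
𝟙-mono {true} {false} a⇒b = contradiction tt a⇒b

𝟙-< : ∀ {a b} → ¬ T a → T b → 𝟙 a < 𝟙 b
𝟙-< {false} {true}  _ _ = ≤-refl
𝟙-< {true}          ¬a _ = contradiction tt ¬a

∧-congˡ-T : ∀ a {b c} → (T a → b ≡ c) → a ∧ b ≡ a ∧ c
∧-congˡ-T true  b≡c = b≡c tt
∧-congˡ-T false _   = refl

≠ᵇ-comm : ∀ a b → (a ≠ᵇ b) ≡ (b ≠ᵇ a)
≠ᵇ-comm true  true  = refl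
≠ᵇ-comm true  false = refl
≠ᵇ-comm false true  = refl
≠ᵇ-comm false false = refl

not-≠ᵇ⇒≡ : ∀ a b → T (not (a ≠ᵇ b)) → a ≡ b
not-≠ᵇ⇒≡ true  true  _ = refl
not-≠ᵇ⇒≡ false false _ = refl

T-∧-proj₁ : ∀ a {b} → T (a ∧ b) → T a
T-∧-proj₁ true _ = tt

T-∧-proj₂ : ∀ a {b} → T (a ∧ b) → T b
T-∧-proj₂ true t = t

T-∧-mapˡ : ∀ a {b c} → (T a → T b) → T (a ∧ c) → T (b ∧ c)
T-∧-mapˡ true {true} _ t = t
T-∧-mapˡ true {false} a⇒b _ = a⇒b tt

¬T⇒T-not : ∀ {a} → ¬ T a → T (not a)
¬T⇒T-not {false} _  = tt
¬T⇒T-not {true}  ¬a = ¬a tt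

+-over-Bool : ∀ (g : Bool → ℕ) b → g true + g false ≡ g b + g (not b)
+-over-Bool g true  = refl
+-over-Bool g false = +-comm (g true) (g false)

<ᵇ≡true⇒< : ∀ m n → (m <ᵇ n) ≡ true → m < n
<ᵇ≡true⇒< m n m<n = <ᵇ⇒< m n (subst T (≡.sym m<n) tt)

<ᵇ≡false⇒≮ : ∀ m n → (m <ᵇ n) ≡ false → ¬ m < n
<ᵇ≡false⇒≮ m n m≮n m<n = subst T m≮n (<⇒<ᵇ m<n)

≥⇒<ᵇ≡false : ∀ {m n} → n ≤ m → (m <ᵇ n) ≡ false
≥⇒<ᵇ≡false {m} {n} n≤m with m <ᵇ n in m<n
... | true  = contradiction (<ᵇ≡true⇒< m n m<n) (≤⇒≯ n≤m)
... | false = refl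

<ᵇ-flip : ∀ {x y} → x ≢ y → not (x <ᵇ y) ≡ (y <ᵇ x)
<ᵇ-flip {x} {y} x≢y with x <ᵇ y in x<y | y <ᵇ x in y<x
... | true  | true  = contradiction (<ᵇ≡true⇒< y x y<x) (<⇒≯ (<ᵇ≡true⇒< x y x<y))
... | true  | false = refl
... | false | true  = refl
... | false | false = contradiction (≤-antisym (≮⇒≥ (<ᵇ≡false⇒≮ y x y<x)) (≮⇒≥ (<ᵇ≡false⇒≮ x y x<y))) x≢y

ordered : Bool → ℕ → ℕ → Bool
ordered true  x y = x <ᵇ y
ordered false x y = y <ᵇ x

ordered-irrefl : ∀ b x → ¬ T (ordered b x x)
ordered-irrefl true  x x<x = <-irrefl refl (<ᵇ⇒< x x x<x)
ordered-irrefl false x x<x = <-irrefl refl (<ᵇ⇒< x x x<x)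

ordered-trans : ∀ b {x y z} → T (ordered b x y) → T (ordered b y z) → T (ordered b x z)
ordered-trans true  {x} {y} {z} x<y y<z = <⇒<ᵇ (<-trans (<ᵇ⇒< x y x<y) (<ᵇ⇒< y z y<z))
ordered-trans false {x} {y} {z} y<x z<y = <⇒<ᵇ (<-trans (<ᵇ⇒< z y z<y) (<ᵇ⇒< y x y<x))

ordered-flip : ∀ b {x y} → x ≢ y → not (ordered b x y) ≡ ordered b y x
ordered-flip true  x≢y = <ᵇ-flip x≢y
ordered-flip false x≢y = <ᵇ-flip (≢-sym x≢y)

ordered-not : ∀ b x y → ordered (not b) x y ≡ ordered b y x
ordered-not true  _ _ = refl
ordered-not false _ _ = refl

sum-mono-≤ : ∀ {n} {f g : Fin n → ℕ} → (∀ i → f i ≤ g i) → sum f ≤ sum g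
sum-mono-≤ {zero}  _   = z≤n
sum-mono-≤ {suc n} f≤g = +-mono-≤ (f≤g Fin.zero) (sum-mono-≤ (f≤g ∘ Fin.suc))

sum-const : ∀ n c → sum {n} (λ _ → c) ≡ n * c
sum-const zero    c = refl
sum-const (suc n) c = cong (c +_) (sum-const n c)

count : ∀ {n} → (Fin n → Bool) → ℕ
count p = sum (λ i → 𝟙 (p i))

count-cong : ∀ {n} {p q : Fin n → Bool} → (∀ i → p i ≡ q i) → count p ≡ count q
count-cong p≡q = sum-cong-≗ (cong 𝟙 ∘ p≡q)

count-mono : ∀ {n} {p q : Fin n → Bool} → (∀ i → T (p i) → T (q i)) → count p ≤ count q
count-mono p⇒q = sum-mono-≤ (λ i → 𝟙-mono (p⇒q i))

count-< : ∀ {n} {p q : Fin n → Bool} → (∀ i → T (p i) → T (q i)) →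
          ∀ j → ¬ T (p j) → T (q j) → count p < count q
count-< {suc n} {p} {q} p⇒q j ¬pj qj = begin-strict
  count p                                   ≡⟨ sum-remove {i = j} (𝟙 ∘ p) ⟩
  𝟙 (p j) + sum (λ i → 𝟙 (p (punchIn j i))) <⟨ +-mono-<-≤ (𝟙-< ¬pj qj)
                                                 (sum-mono-≤ (λ i → 𝟙-mono (p⇒q (punchIn j i)))) ⟩
  𝟙 (q j) + sum (λ i → 𝟙 (q (punchIn j i))) ≡⟨ sum-remove {i = j} (𝟙 ∘ q) ⟨
  count q                                   ∎
  where open ≤-Reasoning

count-true : ∀ n → count {n} (λ _ → true) ≡ n
count-true zero    = refl
count-true (suc n) = cong suc (count-true n)

count≤n : ∀ {n} (p : Fin n → Bool) → count p ≤ n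
count≤n {n} p = subst (count p ≤_) (count-true n) (count-mono {n} {q = λ _ → true} (λ _ _ → tt))

count-split : ∀ {n} (p q : Fin n → Bool) →
              count p ≡ count (λ i → p i ∧ q i) + count (λ i → p i ∧ not (q i))
count-split p q = trans (sum-cong-≗ (λ i → 𝟙-split (p i) (q i)))
                        (∑-distrib-+ (λ i → 𝟙 (p i ∧ q i)) (λ i → 𝟙 (p i ∧ not (q i))))

-- Each pair {u , v} with W u v is counted once in each orientation, and `o`
-- selects exactly one of them.
double-count : ∀ {n} (W o : Fin n → Fin n → Bool) →
               (∀ u v → W u v ≡ W v u) →
               (∀ u v → T (W u v) → not (o u v) ≡ o v u) →
               sum (λ u → count (W u)) ≡ 2 * sum (λ u → count (λ v → W u v ∧ o u v))
double-count W o W-sym o-flip = begin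
  sum (λ u → count (W u))
    ≡⟨ sum-cong-≗ (λ u → count-split (W u) (o u)) ⟩
  sum (λ u → count (λ v → W u v ∧ o u v) + count (λ v → W u v ∧ not (o u v)))
    ≡⟨ ∑-distrib-+ (λ u → count (λ v → W u v ∧ o u v)) (λ u → count (λ v → W u v ∧ not (o u v))) ⟩
  S + sum (λ u → count (λ v → W u v ∧ not (o u v)))
    ≡⟨ cong (S +_) reversed ⟩
  S + S
    ≡⟨ cong (S +_) (+-identityʳ S) ⟨
  2 * S ∎
  where
  open ≡.≡-Reasoning
  S : ℕ
  S = sum (λ u → count (λ v → W u v ∧ o u v))
  flipped : ∀ u v → (W u v ∧ not (o u v)) ≡ (W v u ∧ o v u)
  flipped u v = trans (∧-congˡ-T (W u v) (o-flip u v)) (cong (_∧ o v u) (W-sym u v))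
  reversed : sum (λ u → count (λ v → W u v ∧ not (o u v))) ≡ S
  reversed = trans (sum-cong-≗ (λ u → count-cong (flipped u)))
                   (∑-comm (λ u v → 𝟙 (W v u ∧ o v u)))

fin-injective⇒surjective : ∀ {n} {f : Fin n → Fin n} → Injective _≡_ _≡_ f →
                           ∀ j → ∃ λ i → f i ≡ j
fin-injective⇒surjective {suc n} {f} f-injective j with Finₚ.any? (λ i → f i Finₚ.≟ j)
... | yes hit  = hit
... | no  miss = contradiction (Finₚ.injective⇒≤ squeeze-injective) 1+n≰n
  where
  j≢f : ∀ i → j ≢ f i
  j≢f i j≡fi = miss (i , ≡.sym j≡fi)
  squeeze : Fin (suc n) → Fin n
  squeeze i = punchOut (j≢f i)
  squeeze-injective : Injective _≡_ _≡_ squeeze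
  squeeze-injective eq = f-injective (Finₚ.punchOut-injective (j≢f _) (j≢f _) eq)

sum-reindex : ∀ {n} {f : Fin n → Fin n} → Injective _≡_ _≡_ f →
              (g : Fin n → ℕ) → sum (g ∘ f) ≡ sum g
sum-reindex {f = f} f-injective g = ≡.sym (sum-permute g π)
  where
  surj : ∀ j → ∃ λ i → f i ≡ j
  surj = fin-injective⇒surjective f-injective
  π : Permutation _ _
  π = permutation f (proj₁ ∘ surj) (proj₂ ∘ surj) (λ i → f-injective (proj₂ (surj (f i))))

triangular : ∀ n k → k ≤ n → 2 * sum {n} (λ j → k ∸ toℕ j) ≡ k * suc k
triangular n zero _ =
  cong (2 *_) (trans (sum-cong-≗ {n} (λ j → 0∸n≡0 (toℕ j))) (trans (sum-const n 0) (*-zeroʳ n)))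
triangular (suc n) (suc k) (s≤s k≤n) = begin
  2 * (suc k + sum {n} (λ j → k ∸ toℕ j))      ≡⟨ *-distribˡ-+ 2 (suc k) _ ⟩
  2 * suc k + 2 * sum {n} (λ j → k ∸ toℕ j)    ≡⟨ cong (2 * suc k +_) (triangular n k k≤n) ⟩
  2 * suc k + k * suc k                        ≡⟨ step k ⟩
  suc k * suc (suc k)                          ∎
  where
  open ≡.≡-Reasoning
  step : ∀ k → 2 * suc k + k * suc k ≡ suc k * suc (suc k)
  step = solve-∀

rank : ∀ {n} → Bool → (Fin n → ℕ) → Fin n → ℕ
rank b f v = count (λ u → ordered b (f u) (f v))

rank<n : ∀ {n} b (f : Fin n → ℕ) v → rank b f v < n
rank<n {n} b f v =
  subst (rank b f v <_) (count-true n) (count-< (λ _ _ → tt) v (ordered-irrefl b (f v)) tt)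

rank-monotone : ∀ {n} b (f : Fin n → ℕ) {u v} → T (ordered b (f u) (f v)) → rank b f u < rank b f v
rank-monotone b f {u} u<v =
  count-< (λ w w<u → ordered-trans b w<u u<v) u (ordered-irrefl b (f u)) u<v

rank-injective : ∀ {n} b {f : Fin n → ℕ} → Injective _≡_ _≡_ f → Injective _≡_ _≡_ (rank b f)
rank-injective b {f} f-injective {u} {v} same-rank with f u ≟ f v
... | yes fu≡fv = f-injective fu≡fv
... | no  fu≢fv with T? (ordered b (f u) (f v))
...   | yes u<v = contradiction same-rank (<⇒≢ (rank-monotone b f u<v))
...   | no  u≮v = contradiction (≡.sym same-rank) (<⇒≢ (rank-monotone b f v<u))
  where
  v<u : T (ordered b (f v) (f u))
  v<u = subst T (ordered-flip b fu≢fv) (¬T⇒T-not u≮v)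

-- The ranks of an injective f form a permutation of 0, 1, …, n - 1.
sum-rank : ∀ {n} b {f : Fin n → ℕ} → Injective _≡_ _≡_ f →
           (g : ℕ → ℕ) → sum (λ v → g (rank b f v)) ≡ sum {n} (λ j → g (toℕ j))
sum-rank {n} b {f} f-injective g = begin
  sum (λ v → g (rank b f v))       ≡⟨ sum-cong-≗ (λ v → cong g (Finₚ.toℕ-fromℕ< (rank<n b f v))) ⟨
  sum (λ v → g (toℕ (position v))) ≡⟨ sum-reindex position-injective (g ∘ toℕ) ⟩
  sum {n} (λ j → g (toℕ j))        ∎
  where
  open ≡.≡-Reasoning
  position : Fin n → Fin n
  position v = fromℕ< (rank<n b f v)
  position-injective : Injective _≡_ _≡_ position
  position-injective {u} {v} eq = rank-injective b f-injective (begin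
    rank b f u           ≡⟨ Finₚ.toℕ-fromℕ< (rank<n b f u) ⟨
    toℕ (position u)     ≡⟨ cong toℕ eq ⟩
    toℕ (position v)     ≡⟨ Finₚ.toℕ-fromℕ< (rank<n b f v) ⟩
    rank b f v           ∎)

length-filterᵇ-∷ : ∀ {A : Set} (p : A → Bool) x xs →
                   length (filterᵇ p (x ∷ xs)) ≡ 𝟙 (p x) + length (filterᵇ p xs)
length-filterᵇ-∷ p x xs with p x
... | true  = refl
... | false = refl

length-filterᵇ-tabulate : ∀ {A : Set} {n} (p : A → Bool) (g : Fin n → A) →
                          length (filterᵇ p (tabulate g)) ≡ count (p ∘ g)
length-filterᵇ-tabulate {n = zero}  p g = refl
length-filterᵇ-tabulate {n = suc n} p g =
  trans (length-filterᵇ-∷ p (g Fin.zero) _)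
        (cong (𝟙 (p (g Fin.zero)) +_) (length-filterᵇ-tabulate p (g ∘ Fin.suc)))

length-filterᵇ-map-filterᵇ : ∀ {A B : Set} (p : B → Bool) (g : A → B) (q : A → Bool) xs →
  length (filterᵇ p (map g (filterᵇ q xs))) ≡ length (filterᵇ (λ x → q x ∧ p (g x)) xs)
length-filterᵇ-map-filterᵇ p g q []       = refl
length-filterᵇ-map-filterᵇ p g q (x ∷ xs) with q x
... | false = length-filterᵇ-map-filterᵇ p g q xs
... | true with p (g x)
...   | true  = cong suc (length-filterᵇ-map-filterᵇ p g q xs)
...   | false = length-filterᵇ-map-filterᵇ p g q xs

length-filterᵇ-concatMap : ∀ {A B : Set} {n} (p : B → Bool) (f : A → List B) (g : Fin n → A) →
  length (filterᵇ p (concatMap f (tabulate g))) ≡ sum (λ i → length (filterᵇ p (f (g i))))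
length-filterᵇ-concatMap {n = zero}  p f g = refl
length-filterᵇ-concatMap {n = suc n} p f g = begin
  length (filterᵇ p (f (g Fin.zero) ++ rest))
    ≡⟨ cong length (filter-++ (T? ∘ p) (f (g Fin.zero)) rest) ⟩
  length (filterᵇ p (f (g Fin.zero)) ++ filterᵇ p rest)
    ≡⟨ length-++ (filterᵇ p (f (g Fin.zero))) ⟩
  length (filterᵇ p (f (g Fin.zero))) + length (filterᵇ p rest)
    ≡⟨ cong (length (filterᵇ p (f (g Fin.zero))) +_) (length-filterᵇ-concatMap p f (g ∘ Fin.suc)) ⟩
  sum (λ i → length (filterᵇ p (f (g i)))) ∎
  where
  open ≡.≡-Reasoning
  rest : List _
  rest = concatMap f (tabulate (g ∘ Fin.suc))

length-filterᵇ-↭ : ∀ {A : Set} (p : A → Bool) {xs ys} → xs ↭ ys →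
                   length (filterᵇ p xs) ≡ length (filterᵇ p ys)
length-filterᵇ-↭ p xs↭ys = ↭-length (filter-↭ (T? ∘ p) xs↭ys)

nth-All : ∀ {P : ℕ → Set} {xs} i → All P xs → i < length xs → P (nth xs i)
nth-All zero    (px ∷ _)   _         = px
nth-All (suc i) (_  ∷ pxs) (s≤s i<n) = nth-All i pxs i<n

sorted-count-below : ∀ {xs : List ℕ} {x} i → AllPairs _≤_ xs → x ≤ nth xs i →
                     length (filterᵇ (_<ᵇ x) xs) ≤ i
sorted-count-below {[]} i _ _ = z≤n
sorted-count-below {y ∷ ys} {x} zero (y≤ys ∷ _) x≤y =
  ≤-reflexive (cong length (filter-none (T? ∘ (_<ᵇ x)) (not-below x≤y ∷ All.map (not-below ∘ ≤-trans x≤y) y≤ys)))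
  where
  not-below : ∀ {z} → x ≤ z → ¬ T (z <ᵇ x)
  not-below x≤z z<x = <⇒≱ (<ᵇ⇒< _ x z<x) x≤z
sorted-count-below {y ∷ ys} {x} (suc i) (_ ∷ sorted) x≤nth with y <ᵇ x
... | true  = s≤s (sorted-count-below i sorted x≤nth)
... | false = m≤n⇒m≤1+n (sorted-count-below i sorted x≤nth)

sorted-count-above : ∀ {xs : List ℕ} {x} i → AllPairs _≤_ xs → i < length xs → nth xs i ≤ x →
                     suc i + length (filterᵇ (x <ᵇ_) xs) ≤ length xs
sorted-count-above {y ∷ ys} {x} zero (_ ∷ _) _ y≤x rewrite ≥⇒<ᵇ≡false y≤x =
  s≤s (length-filter (T? ∘ (x <ᵇ_)) ys)
sorted-count-above {y ∷ ys} {x} (suc i) (y≤ys ∷ sorted) (s≤s i<n) nth≤x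
  rewrite ≥⇒<ᵇ≡false (≤-trans (nth-All i y≤ys i<n) nth≤x) =
  s≤s (sorted-count-above i sorted i<n nth≤x)

2*k+1≡1+k+k : ∀ k → 2 * k + 1 ≡ 1 + k + k
2*k+1≡1+k+k = solve-∀

[2*k+1]/2≡k : ∀ k → (2 * k + 1) / 2 ≡ k
[2*k+1]/2≡k k = begin
  (2 * k + 1) / 2 ≡⟨ +-distrib-/-∣ˡ 1 (divides k (*-comm 2 k)) ⟩
  2 * k / 2 + 0   ≡⟨ +-identityʳ _ ⟩
  2 * k / 2       ≡⟨ cong (_/ 2) (*-comm 2 k) ⟩
  k * 2 / 2       ≡⟨ m*n/n≡m k 2 ⟩
  k               ∎
  where open ≡.≡-Reasoning

sorted-middle-count : ∀ k {ys : List ℕ} x → AllPairs _≤_ ys → length ys ≡ 2 * k + 1 →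
                      length (filterᵇ (λ y → ordered (x <ᵇ nth ys k) y x) ys) ≤ k
sorted-middle-count k {ys} x sorted len with x <ᵇ nth ys k in x<m
... | true  = sorted-count-below k sorted (<⇒≤ (<ᵇ≡true⇒< x (nth ys k) x<m))
... | false = +-cancelˡ-≤ (suc k) (length (filterᵇ (x <ᵇ_) ys)) k
                (subst (suc k + length (filterᵇ (x <ᵇ_) ys) ≤_) len′ (sorted-count-above k sorted k<len m≤x))
  where
  len′ : length ys ≡ 1 + k + k
  len′ = trans len (2*k+1≡1+k+k k)
  k<len : k < length ys
  k<len = subst (k <_) (≡.sym len′) (s≤s (m≤m+n k k))
  m≤x : nth ys k ≤ x
  m≤x = ≮⇒≥ (<ᵇ≡false⇒≮ x (nth ys k) x<m)

-- An x below the median of a list of length 2k+1 exceeds at most k of its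
-- entries; an x at or above the median is exceeded by at most k of them.
median-count : ∀ k (xs : List ℕ) x → length xs ≡ 2 * k + 1 →
               length (filterᵇ (λ y → ordered (x <ᵇ median xs) y x) xs) ≤ k
median-count k xs x len = begin
  length (filterᵇ (λ y → ordered (x <ᵇ median xs) y x) xs)
    ≡⟨ length-filterᵇ-↭ _ (sort-↭ xs) ⟨
  length (filterᵇ (λ y → ordered (x <ᵇ median xs) y x) (sort xs))
    ≡⟨ cong (λ m → length (filterᵇ (λ y → ordered (x <ᵇ m) y x) (sort xs))) median≡middle ⟩
  length (filterᵇ (λ y → ordered (x <ᵇ nth (sort xs) k) y x) (sort xs))
    ≤⟨ sorted-middle-count k x (Linked⇒AllPairs ≤-trans (sort-↗ xs)) (trans (↭-length (sort-↭ xs)) len) ⟩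
  k ∎
  where
  open ≤-Reasoning
  median≡middle : median xs ≡ nth (sort xs) k
  median≡middle = cong (nth (sort xs)) (trans (cong (_/ 2) len) ([2*k+1]/2≡k k))

m+[n∸o]≤n : ∀ {m n o} → m ≤ n → m ≤ o → m + (n ∸ o) ≤ n
m+[n∸o]≤n {m} {n} {o} m≤n m≤o with ≤-total o n
... | inj₁ o≤n = ≤-trans (+-monoˡ-≤ (n ∸ o) m≤o) (≤-reflexive (m+[n∸m]≡n o≤n))
... | inj₂ n≤o = begin
  m + (n ∸ o) ≡⟨ cong (m +_) (m≤n⇒m∸n≡0 n≤o) ⟩
  m + 0       ≡⟨ +-identityʳ m ⟩
  m           ≤⟨ m≤n ⟩
  n           ∎
  where open ≤-Reasoning

module MedianCut {n} (G : SimpleGraph n) (id : IDAssignment n) (id-injective : UniqueIDs id)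
                 (k : ℕ) (regular : Regular (2 * k + 1) G) where

  side : Fin n → Bool
  side = medianSide G id

  earlier : Fin n → Fin n → Bool
  earlier v u = ordered (side v) (id u) (id v)

  bichromatic monochromatic : Fin n → Fin n → Bool
  bichromatic   u v = adj G u v ∧ (side u ≠ᵇ side v)
  monochromatic u v = adj G u v ∧ not (side u ≠ᵇ side v)

  charge : Fin n → ℕ
  charge v = count (λ u → monochromatic v u ∧ earlier v u)

  adjacent-distinct : ∀ {u v} → T (adj G u v) → u ≢ v
  adjacent-distinct {u} uv refl = subst T (irrefl G u) uv

  adjacent-ids-distinct : ∀ {u v} → T (adj G u v) → id u ≢ id v
  adjacent-ids-distinct uv = adjacent-distinct uv ∘ id-injective

  degree-count : ∀ v → count (adj G v) ≡ 2 * k + 1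
  degree-count v = trans (≡.sym (length-filterᵇ-tabulate (adj G v) (λ u → u))) (regular v)

  earlier-neighbours : ∀ v → count (λ u → adj G v u ∧ earlier v u) ≤ k
  earlier-neighbours v =
    subst (_≤ k) neighbour-count
          (median-count k (neighbourIDs G id v) (id v) (trans (length-map id (neighbours G v)) (regular v)))
    where
    neighbour-count : length (filterᵇ (λ y → ordered (side v) y (id v)) (neighbourIDs G id v))
                      ≡ count (λ u → adj G v u ∧ earlier v u)
    neighbour-count = trans (length-filterᵇ-map-filterᵇ (λ y → ordered (side v) y (id v)) id (adj G v) (allFin n))
                            (length-filterᵇ-tabulate (λ u → adj G v u ∧ earlier v u) (λ u → u))

  later-neighbours : ∀ v → k < count (λ u → adj G v u ∧ not (earlier v u))
  later-neighbours v = +-cancelʳ-≤ k (suc k) later (begin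
    1 + k + k                ≡⟨ 2*k+1≡1+k+k k ⟨
    2 * k + 1                ≡⟨ degree-count v ⟨
    count (adj G v)          ≡⟨ count-split (adj G v) (earlier v) ⟩
    count (λ u → adj G v u ∧ earlier v u) + later ≤⟨ +-monoˡ-≤ later (earlier-neighbours v) ⟩
    k + later                ≡⟨ +-comm k later ⟩
    later + k                ∎)
    where
    open ≤-Reasoning
    later : ℕ
    later = count (λ u → adj G v u ∧ not (earlier v u))

  vertices≥k : Fin n → k ≤ n
  vertices≥k v = <⇒≤ (<-≤-trans (later-neighbours v) (count≤n _))

  charge≤k : ∀ v → charge v ≤ k
  charge≤k v = ≤-trans (count-mono mono⇒adj) (earlier-neighbours v)
    where
    mono⇒adj : ∀ u → T (monochromatic v u ∧ earlier v u) → T (adj G v u ∧ earlier v u)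
    mono⇒adj u = T-∧-mapˡ (monochromatic v u) (T-∧-proj₁ (adj G v u))

  charge≤rank : ∀ v → charge v ≤ rank (side v) id v
  charge≤rank v = count-mono (λ u → T-∧-proj₂ (monochromatic v u))

  k<opposite-rank : ∀ v → k < rank (not (side v)) id v
  k<opposite-rank v = <-≤-trans (later-neighbours v) (count-mono later⇒opposite)
    where
    later⇒opposite : ∀ u → T (adj G v u ∧ not (earlier v u)) → T (ordered (not (side v)) (id u) (id v))
    later⇒opposite u t =
      subst T (trans (ordered-flip (side v) (≢-sym (adjacent-ids-distinct (T-∧-proj₁ (adj G v u) t))))
                     (≡.sym (ordered-not (side v) (id u) (id v))))
              (T-∧-proj₂ (adj G v u) t)

  charge-bound : ∀ v → charge v + ((k ∸ rank true id v) + (k ∸ rank false id v)) ≤ k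
  charge-bound v = begin
    charge v + ((k ∸ rank true id v) + (k ∸ rank false id v))
      ≡⟨ cong (charge v +_) (+-over-Bool (λ b → k ∸ rank b id v) (side v)) ⟩
    charge v + ((k ∸ rank (side v) id v) + (k ∸ rank (not (side v)) id v))
      ≡⟨ cong (λ m → charge v + ((k ∸ rank (side v) id v) + m)) (m≤n⇒m∸n≡0 (<⇒≤ (k<opposite-rank v))) ⟩
    charge v + ((k ∸ rank (side v) id v) + 0)
      ≡⟨ cong (charge v +_) (+-identityʳ _) ⟩
    charge v + (k ∸ rank (side v) id v)
      ≤⟨ m+[n∸o]≤n (charge≤k v) (charge≤rank v) ⟩
    k ∎
    where open ≤-Reasoning

  slack : Bool → ℕ
  slack b = sum (λ v → k ∸ rank b id v)

  slack-sum : k ≤ n → slack true + slack false ≡ k * suc k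
  slack-sum k≤n = begin
    slack true + slack false ≡⟨ cong₂ _+_ (sum-rank true id-injective (k ∸_)) (sum-rank false id-injective (k ∸_)) ⟩
    Δ + Δ                    ≡⟨ cong (Δ +_) (+-identityʳ Δ) ⟨
    2 * Δ                    ≡⟨ triangular n k k≤n ⟩
    k * suc k                ∎
    where
    open ≡.≡-Reasoning
    Δ : ℕ
    Δ = sum {n} (λ j → k ∸ toℕ j)

  charges-bound : k ≤ n → sum charge + k * suc k ≤ n * k
  charges-bound k≤n = begin
    sum charge + k * suc k
      ≡⟨ cong (sum charge +_) (slack-sum k≤n) ⟨
    sum charge + (slack true + slack false)
      ≡⟨ cong (sum charge +_) (∑-distrib-+ (λ v → k ∸ rank true id v) (λ v → k ∸ rank false id v)) ⟨
    sum charge + sum (λ v → (k ∸ rank true id v) + (k ∸ rank false id v))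
      ≡⟨ ∑-distrib-+ charge (λ v → (k ∸ rank true id v) + (k ∸ rank false id v)) ⟨
    sum (λ v → charge v + ((k ∸ rank true id v) + (k ∸ rank false id v)))
      ≤⟨ sum-mono-≤ charge-bound ⟩
    sum {n} (λ _ → k)
      ≡⟨ sum-const n k ⟩
    n * k ∎
    where open ≤-Reasoning

  bichromatic-sym : ∀ u v → bichromatic u v ≡ bichromatic v u
  bichromatic-sym u v = cong₂ _∧_ (SimpleGraph.sym G u v) (≠ᵇ-comm (side u) (side v))

  monochromatic-sym : ∀ u v → monochromatic u v ≡ monochromatic v u
  monochromatic-sym u v = cong₂ _∧_ (SimpleGraph.sym G u v) (cong not (≠ᵇ-comm (side u) (side v)))

  cutSize-as-sum : cutSize G side ≡ sum (λ u → count (λ v → bichromatic u v ∧ (toℕ u <ᵇ toℕ v)))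
  cutSize-as-sum = begin
    cutSize G side
      ≡⟨ length-filterᵇ-concatMap edge pairs-from (λ u → u) ⟩
    sum (λ u → length (filterᵇ edge (pairs-from u)))
      ≡⟨ sum-cong-≗ (λ u → trans (length-filterᵇ-map-filterᵇ edge (u ,_) (λ v → toℕ u <ᵇ toℕ v) (allFin n))
                                  (length-filterᵇ-tabulate (λ v → (toℕ u <ᵇ toℕ v) ∧ bichromatic u v) (λ v → v))) ⟩
    sum (λ u → count (λ v → (toℕ u <ᵇ toℕ v) ∧ bichromatic u v))
      ≡⟨ sum-cong-≗ (λ u → count-cong (λ v → ∧-comm (toℕ u <ᵇ toℕ v) (bichromatic u v))) ⟩
    sum (λ u → count (λ v → bichromatic u v ∧ (toℕ u <ᵇ toℕ v))) ∎
    where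
    open ≡.≡-Reasoning
    edge : Fin n × Fin n → Bool
    edge (u , v) = bichromatic u v
    pairs-from : Fin n → List (Fin n × Fin n)
    pairs-from u = map (u ,_) (filterᵇ (λ v → toℕ u <ᵇ toℕ v) (allFin n))

  cut-edges : sum (λ u → count (bichromatic u)) ≡ 2 * cutSize G side
  cut-edges = trans (double-count bichromatic (λ u v → toℕ u <ᵇ toℕ v) bichromatic-sym index-flip)
                    (cong (2 *_) (≡.sym cutSize-as-sum))
    where
    index-flip : ∀ u v → T (bichromatic u v) → not (toℕ u <ᵇ toℕ v) ≡ (toℕ v <ᵇ toℕ u)
    index-flip u v t = <ᵇ-flip (adjacent-distinct (T-∧-proj₁ (adj G u v) t) ∘ Finₚ.toℕ-injective)

  uncut-edges : sum (λ u → count (monochromatic u)) ≡ 2 * sum charge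
  uncut-edges = double-count monochromatic earlier monochromatic-sym earlier-flip
    where
    earlier-flip : ∀ u v → T (monochromatic u v) → not (earlier u v) ≡ earlier v u
    earlier-flip u v t =
      trans (ordered-flip (side u) (≢-sym (adjacent-ids-distinct (T-∧-proj₁ (adj G u v) t))))
            (cong (λ b → ordered b (id u) (id v)) (not-≠ᵇ⇒≡ (side u) (side v) (T-∧-proj₂ (adj G u v) t)))

  handshake : n * (2 * k + 1) ≡ 2 * cutSize G side + 2 * sum charge
  handshake = begin
    n * (2 * k + 1)
      ≡⟨ sum-const n (2 * k + 1) ⟨
    sum {n} (λ _ → 2 * k + 1)
      ≡⟨ sum-cong-≗ degree-count ⟨
    sum (λ v → count (adj G v))
      ≡⟨ sum-cong-≗ (λ v → count-split (adj G v) (λ u → side v ≠ᵇ side u)) ⟩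
    sum (λ v → count (bichromatic v) + count (monochromatic v))
      ≡⟨ ∑-distrib-+ (λ v → count (bichromatic v)) (λ v → count (monochromatic v)) ⟩
    sum (λ v → count (bichromatic v)) + sum (λ v → count (monochromatic v))
      ≡⟨ cong₂ _+_ cut-edges uncut-edges ⟩
    2 * cutSize G side + 2 * sum charge ∎
    where open ≡.≡-Reasoning

median-cut-arithmetic : ∀ {n k c s} → n * (2 * k + 1) ≡ 2 * c + 2 * s → s + k * suc k ≤ n * k →
                        2 * n + (2 * k + 1 ∸ 1) * (2 * k + 1 + 1) ≤ 4 * c
median-cut-arithmetic {n} {k} {c} {s} edges bound = begin
  2 * n + (2 * k + 1 ∸ 1) * (2 * k + 1 + 1)
    ≡⟨ cong (λ m → 2 * n + m * (2 * k + 1 + 1)) (m+n∸n≡m (2 * k) 1) ⟩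
  2 * n + 2 * k * (2 * k + 1 + 1)
    ≡⟨ expand n k ⟩
  2 * (n + 2 * (k * suc k))
    ≤⟨ *-monoʳ-≤ 2 (+-cancelʳ-≤ (2 * s) (n + 2 * (k * suc k)) (2 * c) key) ⟩
  2 * (2 * c)
    ≡⟨ *-assoc 2 2 c ⟨
  4 * c ∎
  where
  open ≤-Reasoning
  expand : ∀ n k → 2 * n + 2 * k * (2 * k + 1 + 1) ≡ 2 * (n + 2 * (k * suc k))
  expand = solve-∀
  regroup : ∀ n s t → n + 2 * t + 2 * s ≡ n + 2 * (s + t)
  regroup = solve-∀
  odd : ∀ n k → n + 2 * (n * k) ≡ n * (2 * k + 1)
  odd = solve-∀
  key : n + 2 * (k * suc k) + 2 * s ≤ 2 * c + 2 * s
  key = begin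
    n + 2 * (k * suc k) + 2 * s ≡⟨ regroup n s (k * suc k) ⟩
    n + 2 * (s + k * suc k)     ≤⟨ +-monoʳ-≤ n (*-monoʳ-≤ 2 bound) ⟩
    n + 2 * (n * k)             ≡⟨ odd n k ⟩
    n * (2 * k + 1)             ≡⟨ edges ⟩
    2 * c + 2 * s               ∎

theorem6 : (d n : ℕ) → (k : ℕ) → d ≡ 2 * k + 1 → 1 ≤ n →
    (G : SimpleGraph n) → Regular d G →
    (id : IDAssignment n) → UniqueIDs id →
    2 * n + (d ∸ 1) * (d + 1) ≤ 4 * cutSize G (medianSide G id)
theorem6 .(2 * k + 1) n k refl 1≤n G regular id id-injective =
  median-cut-arithmetic {n} {k} {cutSize G side} {sum charge} handshake (charges-bound k≤n)
  where
  open MedianCut G id id-injective k regular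
  k≤n : k ≤ n
  k≤n = vertices≥k (fromℕ< 1≤n)
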